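{- Let $G=(V,E)$ be a finite simple graph and $x,y\in\{0,1\}^V$. The following are equivalent: (1) there is a word $w\in V^*$ with $F_G^w(x)=y$; (2) there is a word $w$ in which every vertex occurs at most once, such that the set of vertices occurring in $w$ is exactly $\{v\in V: x_v\neq y_v\}$ and $F_G^w(x)=y$; (3) every edge of the induced subgraph $G[\{v:y_v=1\}]$ is an edge of $G[\{v:x_v=1\}]$, and for every connected component $C$ of $G[\{v:x_v=1\}]$ there is some $v\in C$ with $y_v=1$.
   Context: The MIS network of $G$ is the map $F_G:\{0,1\}^V\to\{0,1\}^V$ given by $F_G(x)_v=\bigwedge_{u\in N(v)}\neg x_u$ (with $F_G(x)_v=1$ if $v$ has no neighbours), where $N(v)$ is the set of neighbours of $v$. For $v\in V$, $F_G^v$ is the map with $F_G^v(x)_v=F_G(x)_v$ and $F_G^v(x)_u=x_u$ for $u\neq v$. For a word $w=w_1\dots w_l\in V^*$, $F_G^w=F_G^{w_l}\circ\dots\circ F_G^{w_1}$ (the identity for the empty word). -}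

module Defs where

open import Data.Nat using (ℕ)
open import Data.Fin using (Fin; _≟_)
open import Data.Bool using (Bool; true; false; not; _∧_; if_then_else_)
open import Data.List using (List; []; _∷_; map; allFin)
open import Data.Bool.ListAction using (and)
open import Data.Product using (_×_)
open import Relation.Nullary.Decidable using (⌊_⌋)
open import Relation.Binary.PropositionalEquality using (_≡_)
open import Relation.Binary.Construct.Closure.ReflexiveTransitive using (Star)

record SimpleGraph (n : ℕ) : Set where
  field
    adj    : Fin n → Fin n → Bool
    sym    : ∀ u v → adj u v ≡ adj v u
    irrefl : ∀ v → adj v v ≡ false
open SimpleGraph public

Config : ℕ → Set
Config n = Fin n → Bool

F : ∀ {n} → SimpleGraph n → Config n → Config n
F {n} G x v = and (map (λ u → not (adj G v u ∧ x u)) (allFin n))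

Fv : ∀ {n} → SimpleGraph n → Fin n → Config n → Config n
Fv G v x u = if ⌊ u ≟ v ⌋ then F G x v else x u

-- F^w = F^{w_l} ∘ … ∘ F^{w_1}: the first letter is applied first
Fw : ∀ {n} → SimpleGraph n → List (Fin n) → Config n → Config n
Fw G []      x = x
Fw G (v ∷ w) x = Fw G w (Fv G v x)

InducedEdge : ∀ {n} → SimpleGraph n → Config n → Fin n → Fin n → Set
InducedEdge G s u v = s u ≡ true × s v ≡ true × adj G u v ≡ true

Connected : ∀ {n} → SimpleGraph n → Config n → Fin n → Fin n → Set
Connected G s = Star (InducedEdge G s)

-- A local update never creates an edge inside the on-set (a vertex is switched on only when
-- all its neighbours are off), and a vertex is switched off only when it has a neighbour that
-- stays on.  So along any run every vertex of the original on-set stays joined, inside that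
-- set, to a vertex that is still on: this is (1) ⇒ (3).  Conversely, under (3) start from x
-- and switch off the vertices of x ∖ y, each while it still has an on neighbour (in reverse
-- order of discovery from x ∧ y inside G[x]), arriving at x ∧ y; then switch on the vertices
-- of y ∖ x in any order, which works because by (3) none of them has a neighbour in y.
-- Each vertex where x and y differ is updated exactly once.

module Submission where

open import Defs
open import Data.Nat using (ℕ)
open import Data.Fin using (Fin)
open import Data.Bool using (Bool; true)
open import Data.List using (List)
open import Data.List.Membership.Propositional using (_∈_)
open import Data.List.Relation.Unary.Unique.Propositional using (Unique)
open import Data.Product using (_×_; Σ; ∃)
open import Function.Bundles using (_⇔_)
open import Relation.Binary.PropositionalEquality using (_≡_; _≢_)

open import Level using (Level; 0ℓ)
open import Data.Bool using (false; not; _∧_)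
import Data.Bool as Bool
open import Data.Bool.Properties using (¬-not; T-≡; T-not-≡)
open import Data.Fin using (_≟_)
open import Data.Fin.Properties using (any?)
open import Data.Fin.Subset as Subset using (Subset; _⊂_)
open import Data.Fin.Subset.Induction using (⊃-wellFounded)
open import Data.List using ([]; _∷_; allFin)
open import Data.Bool.ListAction using (and)
open import Data.List.Membership.Propositional using (_∉_)
open import Data.List.Membership.Propositional.Properties using (∈-allFin)
open import Data.List.Properties using (map-cong)
open import Data.List.Relation.Unary.Any using (here; there)
import Data.List.Relation.Unary.All as All
open import Data.List.Relation.Unary.All.Properties using (all⁺; all⁻; ¬Any⇒All¬)
open import Data.List.Relation.Unary.AllPairs using ([]; _∷_)
open import Data.Product using (_,_; proj₁; proj₂; ∃₂)
open import Data.Sum using (_⊎_; inj₁; inj₂)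
open import Data.Vec using (tabulate)
open import Data.Vec.Properties using (lookup⇒[]=; []=⇒lookup; lookup∘tabulate)
open import Data.Vec.Functional using (updateAt)
open import Data.Vec.Functional.Properties using (updateAt-updates; updateAt-minimal)
open import Function using (_∘_; id; const; flip)
open import Function.Bundles using (mk⇔; Equivalence)
open import Function.Properties.Equivalence using () renaming (trans to ⇔-trans)
open import Induction.WellFounded using (WellFounded; module Subrelation; module All)
open import Relation.Binary using (Rel)
import Relation.Binary.Construct.On as On
open import Relation.Binary.Construct.Closure.ReflexiveTransitive using (Star; ε; _◅_; _◅◅_)
import Relation.Binary.Construct.Closure.ReflexiveTransitive as Star
open import Relation.Binary.PropositionalEquality using (refl; trans; cong; cong₂; subst; _≗_)
import Relation.Binary.PropositionalEquality as ≡
open import Relation.Nullary using (yes; no; ¬?; contradiction)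
open import Relation.Nullary.Decidable using (⌊_⌋; _×-dec_; decidable-stable)

private
  variable
    n : ℕ
    ℓ ℓ′ : Level
    A : Set ℓ
    R : Rel A ℓ′
    i j : A
    x y z z' : Config n
    a u v : Fin n

∧≡true⇒ : ∀ {p q} → p ∧ q ≡ true → p ≡ true × q ≡ true
∧≡true⇒ {true} {true} _ = refl , refl

crossingStep : (P : A → Bool) → Star R i j → P i ≡ false → P j ≡ true →
               ∃₂ λ p q → R p q × P p ≡ false × P q ≡ true
crossingStep P ε Pi Pj = contradiction (trans (≡.sym Pi) Pj) λ ()
crossingStep {i = i} P (_◅_ {j = k} Rik k⋆j) Pi Pj with P k in Pk
... | true  = i , k , Rik , Pi , Pk
... | false = crossingStep P k⋆j Pk Pj

_⊆ᶜ_ : Rel (Config n) 0ℓ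
z ⊆ᶜ z' = ∀ u → z u ≡ true → z' u ≡ true

_⊂ᶜ_ : Rel (Config n) 0ℓ
z ⊂ᶜ z' = z ⊆ᶜ z' × ∃ λ v → z v ≡ false × z' v ≡ true

⊆ᶜ-differs : z ⊆ᶜ z' → z v ≢ z' v → z v ≡ false × z' v ≡ true
⊆ᶜ-differs {z = z} {z'} {v} z⊆z' zv≢z'v = zv≡false , trans (¬-not (zv≢z'v ∘ ≡.sym)) (cong not zv≡false)
  where
  zv≡false : z v ≡ false
  zv≡false = ¬-not (λ zv → zv≢z'v (trans zv (≡.sym (z⊆z' v zv))))

≗-or-differs : (z z' : Config n) → z ≗ z' ⊎ ∃ λ v → z v ≢ z' v
≗-or-differs z z' with any? (λ v → ¬? (z v Bool.≟ z' v))
... | yes differs = inj₂ differs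
... | no ¬differs = inj₁ λ v → decidable-stable (z v Bool.≟ z' v) (λ zv≢z'v → ¬differs (v , zv≢z'v))

support : Config n → Subset n
support = tabulate

⊂ᶜ⇒⊂ : z ⊂ᶜ z' → support z ⊂ support z'
⊂ᶜ⇒⊂ {z = z} {z'} (z⊆z' , v , zv , z'v) =
  (λ {u} u∈z → ∈support (z⊆z' u (support∈ u∈z))) , v , ∈support z'v , λ v∈z → contradiction (trans (≡.sym zv) (support∈ v∈z)) λ ()
  where
  ∈support : ∀ {s : Config _} {u} → s u ≡ true → u Subset.∈ support s
  ∈support {s = s} {u} su = lookup⇒[]= u (support s) (trans (lookup∘tabulate s u) su)
  support∈ : ∀ {s : Config _} {u} → u Subset.∈ support s → s u ≡ true
  support∈ {s = s} {u} u∈s = trans (≡.sym (lookup∘tabulate s u)) ([]=⇒lookup u∈s)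

⊃ᶜ-wellFounded : WellFounded (flip (_⊂ᶜ_ {n}))
⊃ᶜ-wellFounded = Subrelation.wellFounded ⊂ᶜ⇒⊂ (On.wellFounded support ⊃-wellFounded)

⊃ᶜ-rec : (P : Config n → Set) → (∀ z → (∀ {z'} → z ⊂ᶜ z' → P z') → P z) → ∀ z → P z
⊃ᶜ-rec = All.wfRec ⊃ᶜ-wellFounded 0ℓ

⊂ᶜ-updateAt : z v ≡ false → z ⊂ᶜ updateAt z v (const true)
⊂ᶜ-updateAt {z = z} {v} zv = z⊆z∪v , v , zv , updateAt-updates v z
  where
  z⊆z∪v : z ⊆ᶜ updateAt z v (const true)
  z⊆z∪v u zu with u ≟ v
  ... | yes refl = updateAt-updates u z
  ... | no u≢v   = trans (updateAt-minimal u v z u≢v) zu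

module _ (G : SimpleGraph n) where

  F≡true⇔ : F G z v ≡ true ⇔ (∀ u → adj G v u ≡ true → z u ≡ false)
  F≡true⇔ {z} {v} = mk⇔ to from
    where
    to : F G z v ≡ true → ∀ u → adj G v u ≡ true → z u ≡ false
    to Fzv u vu = Equivalence.to T-not-≡
      (subst (λ b → Bool.T (not (b ∧ z u))) vu
        (All.lookup (all⁺ _ (allFin n) (Equivalence.from T-≡ Fzv)) (∈-allFin u)))
    from : (∀ u → adj G v u ≡ true → z u ≡ false) → F G z v ≡ true
    from off = Equivalence.to T-≡ (all⁻ _ {allFin n} (All.tabulate λ {u} _ → neighbourOff u))
      where
      neighbourOff : ∀ u → Bool.T (not (adj G v u ∧ z u))
      neighbourOff u with adj G v u in vu
      ... | false = _
      ... | true  = Equivalence.from T-not-≡ (off u vu)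

  F≡false⇔ : F G z v ≡ false ⇔ (∃ λ u → adj G v u ≡ true × z u ≡ true)
  F≡false⇔ {z} {v} = mk⇔ to from
    where
    to : F G z v ≡ false → ∃ λ u → adj G v u ≡ true × z u ≡ true
    to Fzv with any? (λ u → (adj G v u Bool.≟ true) ×-dec (z u Bool.≟ true))
    ... | yes onNeighbour = onNeighbour
    ... | no ¬onNeighbour = contradiction (trans (≡.sym Fzv) (Equivalence.from F≡true⇔ λ u vu →
                              ¬-not λ zu → ¬onNeighbour (u , vu , zu))) λ ()
    from : (∃ λ u → adj G v u ≡ true × z u ≡ true) → F G z v ≡ false
    from (u , vu , zu) = ¬-not λ Fzv → contradiction (trans (≡.sym zu) (Equivalence.to F≡true⇔ Fzv u vu)) λ ()

  adj⇒≢ : adj G u v ≡ true → u ≢ v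
  adj⇒≢ {u} uv refl = contradiction (trans (≡.sym uv) (irrefl G u)) λ ()

  Fv-self : ∀ v z → Fv G v z v ≡ F G z v
  Fv-self v z with v ≟ v
  ... | yes _   = refl
  ... | no v≢v = contradiction refl v≢v

  Fv-other : u ≢ v → Fv G v z u ≡ z u
  Fv-other {u} {v} u≢v with u ≟ v
  ... | yes u≡v = contradiction u≡v u≢v
  ... | no _    = refl

  F-cong : z ≗ z' → ∀ v → F G z v ≡ F G z' v
  F-cong z≗z' v = cong and (map-cong (λ u → cong (λ b → not (adj G v u ∧ b)) (z≗z' u)) (allFin _))

  Fv-cong : z ≗ z' → Fv G v z ≗ Fv G v z'
  Fv-cong {v = v} z≗z' u = cong₂ (Bool.if_then_else_ ⌊ u ≟ v ⌋) (F-cong z≗z' v) (z≗z' u)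

  Fw-cong : ∀ w → z ≗ z' → Fw G w z ≗ Fw G w z'
  Fw-cong []      z≗z' = z≗z'
  Fw-cong (v ∷ w) z≗z' = Fw-cong w (Fv-cong z≗z')

  Fv-on⇒neighbours-off : Fv G v z v ≡ true → adj G v u ≡ true → Fv G v z u ≡ false
  Fv-on⇒neighbours-off {v} {z} {u} Fv-on vu =
    trans (Fv-other (adj⇒≢ vu ∘ ≡.sym))
          (Equivalence.to F≡true⇔ (trans (≡.sym (Fv-self v z)) Fv-on) u vu)

  Fv-on-edge⇒≢ : ∀ {s t} → Fv G a z s ≡ true → Fv G a z t ≡ true → adj G s t ≡ true → s ≢ a
  Fv-on-edge⇒≢ z's z't st refl = contradiction (trans (≡.sym z't) (Fv-on⇒neighbours-off z's st)) λ ()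

  inducedEdge-Fv-⊆ : ∀ {u v} → InducedEdge G (Fv G a z) u v → InducedEdge G z u v
  inducedEdge-Fv-⊆ {u = u} {v} (z'u , z'v , uv) =
    trans (≡.sym (Fv-other (Fv-on-edge⇒≢ z'u z'v uv))) z'u ,
    trans (≡.sym (Fv-other (Fv-on-edge⇒≢ z'v z'u (trans (sym G v u) uv)))) z'v ,
    uv

  inducedEdge-Fw-⊆ : ∀ w {u v} → InducedEdge G (Fw G w z) u v → InducedEdge G z u v
  inducedEdge-Fw-⊆ []      = id
  inducedEdge-Fw-⊆ (a ∷ w) = inducedEdge-Fv-⊆ ∘ inducedEdge-Fw-⊆ w

  survivor-Fv : z u ≡ true → ∃ λ u' → Connected G z u u' × Fv G a z u' ≡ true
  survivor-Fv {z} {u} {a} zu with u ≟ a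
  ... | no u≢a  = u , ε , trans (Fv-other u≢a) zu
  ... | yes refl with F G z u Bool.≟ true
  ...   | yes Fzu = u , ε , trans (Fv-self u z) Fzu
  ...   | no Fzu≢true with Equivalence.to F≡false⇔ (¬-not Fzu≢true)
  ...     | b , ub , zb = b , (zu , zb , ub) ◅ ε , trans (Fv-other (adj⇒≢ ub ∘ ≡.sym)) zb

  survivor-Fw : ∀ w → z u ≡ true → ∃ λ u' → Connected G z u u' × Fw G w z u' ≡ true
  survivor-Fw []      zu = _ , ε , zu
  survivor-Fw (a ∷ w) zu with survivor-Fv {a = a} zu
  ... | u₁ , u⋆u₁ , z'u₁ with survivor-Fw w z'u₁
  ...   | u₂ , u₁⋆u₂ , wu₂ = u₂ , u⋆u₁ ◅◅ Star.map inducedEdge-Fv-⊆ u₁⋆u₂ , wu₂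

  Reachable : Config n → Config n → Set
  Reachable x y = Σ (List (Fin n)) λ w → Fw G w x ≗ y

  ReachableByFlips : Config n → Config n → Set
  ReachableByFlips x y =
    Σ (List (Fin n)) λ w → Unique w × (∀ v → (v ∈ w) ⇔ (x v ≢ y v)) × Fw G w x ≗ y

  InducedEdges⊆ : Config n → Config n → Set
  InducedEdges⊆ y x = ∀ u v → InducedEdge G y u v → InducedEdge G x u v

  EveryComponentMeets : Config n → Config n → Set
  EveryComponentMeets x y = ∀ v → x v ≡ true → ∃ λ u → Connected G x v u × y u ≡ true

  reachable⇒inducedEdges⊆ : Reachable x y → InducedEdges⊆ y x
  reachable⇒inducedEdges⊆ (w , x↝y) u v (yu , yv , uv) =
    inducedEdge-Fw-⊆ w (trans (x↝y u) yu , trans (x↝y v) yv , uv)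

  reachable⇒everyComponentMeets : Reachable x y → EveryComponentMeets x y
  reachable⇒everyComponentMeets (w , x↝y) v xv with survivor-Fw w xv
  ... | u , v⋆u , wu = u , v⋆u , trans (≡.sym (x↝y u)) wu

  reachableByFlips-refl : z ≗ y → ReachableByFlips z y
  reachableByFlips-refl z≗y = [] , [] , (λ v → mk⇔ (λ ()) (λ z≢y → contradiction (z≗y v) z≢y)) , z≗y

  reachableByFlips-resp : z ≗ z' → ReachableByFlips z y → ReachableByFlips z' y
  reachableByFlips-resp {y = y} z≗z' (w , unique , flips , z↝y) =
    w , unique ,
    (λ v → subst (λ b → (v ∈ w) ⇔ (b ≢ y v)) (z≗z' v) (flips v)) ,
    (λ v → trans (≡.sym (Fw-cong w z≗z' v)) (z↝y v))

  reachableByFlips-∷ : z v ≢ y v → Fv G v z v ≡ y v →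
                       ReachableByFlips (Fv G v z) y → ReachableByFlips z y
  reachableByFlips-∷ {z} {v} {y} zv≢yv z'v≡yv (w , unique , flips , z'↝y) =
    v ∷ w , ¬Any⇒All¬ w v∉w ∷ unique , flips′ , z'↝y
    where
    v∉w : v ∉ w
    v∉w v∈w = Equivalence.to (flips v) v∈w z'v≡yv
    flips′ : ∀ u → (u ∈ v ∷ w) ⇔ (z u ≢ y u)
    flips′ u with u ≟ v
    ... | yes refl = mk⇔ (const zv≢yv) (const (here refl))
    ... | no u≢v   = ⇔-trans (mk⇔ (λ { (here u≡v) → contradiction u≡v u≢v ; (there u∈w) → u∈w }) there)
                             (subst (λ b → (u ∈ w) ⇔ (b ≢ y u)) (Fv-other u≢v) (flips u))

  ⊆ᶜ-Fv : F G z v ≡ true → z ⊆ᶜ Fv G v z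
  ⊆ᶜ-Fv {v = v} Fzv u zu with u ≟ v
  ... | yes refl = Fzv
  ... | no _     = zu

  reachableByFlips-switchOn : ∀ z → z ⊆ᶜ y → (∀ u v → InducedEdge G y u v → z u ≡ true) →
                              ReachableByFlips z y
  reachableByFlips-switchOn {y} = ⊃ᶜ-rec SwitchOnTarget step
    where
    SwitchOnTarget : Config n → Set
    SwitchOnTarget z = z ⊆ᶜ y → (∀ u v → InducedEdge G y u v → z u ≡ true) → ReachableByFlips z y

    step : ∀ z → (∀ {z'} → z ⊂ᶜ z' → SwitchOnTarget z') → SwitchOnTarget z
    step z rec z⊆y yEdges with ≗-or-differs z y
    ... | inj₁ z≗y = reachableByFlips-refl z≗y
    ... | inj₂ (v , zv≢yv) with ⊆ᶜ-differs z⊆y zv≢yv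
    ...   | zv , yv = reachableByFlips-∷ zv≢yv (trans z'v (≡.sym yv))
                        (rec (⊆ᶜ-Fv Fzv , v , zv , z'v) z'⊆y (λ u w e → ⊆ᶜ-Fv Fzv u (yEdges u w e)))
      where
      Fzv : F G z v ≡ true
      Fzv = Equivalence.from F≡true⇔ λ u vu →
        ¬-not λ zu → contradiction (trans (≡.sym zv) (yEdges v u (yv , z⊆y u zu , vu))) λ ()
      z'v : Fv G v z v ≡ true
      z'v = trans (Fv-self v z) Fzv
      z'⊆y : Fv G v z ⊆ᶜ y
      z'⊆y u z'u with u ≟ v
      ... | yes refl = yv
      ... | no _     = z⊆y u z'u

  connected⇒on : Connected G x u v → x u ≡ true → x v ≡ true
  connected⇒on ε                     xu = xu
  connected⇒on ((_ , xw , _) ◅ w⋆v) _  = connected⇒on w⋆v xw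

  reachableByFlips-insert : ∀ {p q} → adj G p q ≡ true → z q ≡ true → z p ≡ false → y p ≡ false →
                            ReachableByFlips z y → ReachableByFlips (updateAt z p (const true)) y
  reachableByFlips-insert {z} {y} {p} {q} pq zq zp yp z↝y =
    reachableByFlips-∷ (λ z∪p≡y → contradiction (trans (≡.sym z∪p-p) (trans z∪p≡y yp)) λ ())
                       (trans (Fv≗z p) (trans zp (≡.sym yp)))
                       (reachableByFlips-resp (≡.sym ∘ Fv≗z) z↝y)
    where
    z∪p : Config n
    z∪p = updateAt z p (const true)
    z∪p-p : z∪p p ≡ true
    z∪p-p = updateAt-updates p z
    Fv≗z : Fv G p z∪p ≗ z
    Fv≗z a with a ≟ p
    ... | yes refl = trans (Equivalence.from F≡false⇔ (q , pq , trans (updateAt-minimal q p z (adj⇒≢ pq ∘ ≡.sym)) zq))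
                           (≡.sym zp)
    ... | no a≢p   = updateAt-minimal a p z a≢p

  reachableByFlips-switchOff : EveryComponentMeets x y →
    ∀ z → (∀ u → x u ≡ true → y u ≡ true → z u ≡ true) → z ⊆ᶜ x →
    ReachableByFlips z y → ReachableByFlips x y
  reachableByFlips-switchOff {x} {y} meets = ⊃ᶜ-rec SwitchOffSource step
    where
    SwitchOffSource : Config n → Set
    SwitchOffSource z = (∀ u → x u ≡ true → y u ≡ true → z u ≡ true) → z ⊆ᶜ x →
                        ReachableByFlips z y → ReachableByFlips x y

    -- The word is built backwards: z grows from x ∧ y to x, each step prepending the
    -- switch-off of a vertex p ∈ x ∖ z that has an on neighbour q in z.
    step : ∀ z → (∀ {z'} → z ⊂ᶜ z' → SwitchOffSource z') → SwitchOffSource z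
    step z rec x∧y⊆z z⊆x z↝y with ≗-or-differs z x
    ... | inj₁ z≗x = reachableByFlips-resp z≗x z↝y
    ... | inj₂ (u , zu≢xu) with ⊆ᶜ-differs z⊆x zu≢xu
    ...   | zu , xu with meets u xu
    ...     | u' , u⋆u' , yu' with crossingStep z u⋆u' zu (x∧y⊆z u' (connected⇒on u⋆u' xu) yu')
    ...       | p , q , (xp , _ , pq) , zp , zq =
      rec z⊂z∪p (λ a xa ya → proj₁ z⊂z∪p a (x∧y⊆z a xa ya)) z∪p⊆x
          (reachableByFlips-insert pq zq zp yp z↝y)
      where
      yp : y p ≡ false
      yp = ¬-not λ yp → contradiction (trans (≡.sym zp) (x∧y⊆z p xp yp)) λ ()
      z⊂z∪p : z ⊂ᶜ updateAt z p (const true)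
      z⊂z∪p = ⊂ᶜ-updateAt zp
      z∪p⊆x : updateAt z p (const true) ⊆ᶜ x
      z∪p⊆x a z∪p-a with a ≟ p
      ... | yes refl = xp
      ... | no a≢p   = z⊆x a (trans (≡.sym (updateAt-minimal a p z a≢p)) z∪p-a)

  criterion⇒reachableByFlips : InducedEdges⊆ y x × EveryComponentMeets x y → ReachableByFlips x y
  criterion⇒reachableByFlips {y} {x} (edges , meets) =
    reachableByFlips-switchOff meets x∧y (λ u xu yu → cong₂ _∧_ xu yu) (λ u → proj₁ ∘ ∧≡true⇒)
      (reachableByFlips-switchOn x∧y (λ u → proj₂ ∘ ∧≡true⇒)
        (λ u v yuv → cong₂ _∧_ (proj₁ (edges u v yuv)) (proj₁ yuv)))
    where
    x∧y : Config n
    x∧y u = x u ∧ y u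

  reachable⇒criterion : Reachable x y → InducedEdges⊆ y x × EveryComponentMeets x y
  reachable⇒criterion x↝y = reachable⇒inducedEdges⊆ x↝y , reachable⇒everyComponentMeets x↝y

  reachableByFlips⇒reachable : ReachableByFlips x y → Reachable x y
  reachableByFlips⇒reachable (w , _ , _ , x↝y) = w , x↝y

proposition4p2 : (n : ℕ) (G : SimpleGraph n) (x y : Config n) →
  let
    c1 = Σ (List (Fin n)) λ w → ∀ v → Fw G w x v ≡ y v
    c2 = Σ (List (Fin n)) λ w → Unique w × (∀ v → (v ∈ w) ⇔ (x v ≢ y v)) × (∀ v → Fw G w x v ≡ y v)
    c3 = (∀ u v → InducedEdge G y u v → InducedEdge G x u v)
         × (∀ v → x v ≡ true → ∃ λ u → Connected G x v u × y u ≡ true)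
  in (c1 ⇔ c2) × (c1 ⇔ c3)
proposition4p2 n G x y =
  mk⇔ (criterion⇒reachableByFlips G ∘ reachable⇒criterion G) (reachableByFlips⇒reachable G) ,
  mk⇔ (reachable⇒criterion G) (reachableByFlips⇒reachable G ∘ criterion⇒reachableByFlips G)
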